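{- Let $\Phi$ be an orientable directed embedding of an eulerian digraph $D$ (with a fixed orientation), and let $f$ be the vertex identification that identifies three distinct vertices $v_1,v_2,v_3$ of $D$ into a single vertex $v$ and leaves all other vertices unchanged. For $i\in\{1,2,3\}$ let $A_i$ be an antiface of $\Phi$ incident with $v_i$, and let $\mathcal{A}$ be the set containing $A_1,A_2,A_3$ (not necessarily distinct). Then $D/f$ has an orientable directed embedding $\Phi'$ whose faces are the faces $B/f$ for all faces $B\notin\mathcal{A}$ of $\Phi$, together with a set $\mathcal{A}'$ of antifaces replacing those in $\mathcal{A}$, where: (a) if $|\mathcal{A}|=3$ then $|\mathcal{A}'|=1$; (b) if $|\mathcal{A}|=2$ then $|\mathcal{A}'|=2$; (c) if $|\mathcal{A}|=1$ then $|\mathcal{A}'|=1$. In all cases $\mathcal{A}'$ uses the same set of half-arcs as $\mathcal{A}$, and $|\mathcal{A}'|\le|\mathcal{A}|$.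
   Context: Digraphs are finite and may have loops and multiple arcs; each arc consists of two half-arcs. A digraph is eulerian if it has a directed circuit using every arc and vertex. Embeddings are cellular in closed surfaces; a directed embedding is one in which every face is bounded by a directed closed walk. In an oriented directed embedding, a face is a proface if its facial directed walk is clockwise and an antiface if anticlockwise. A vertex identification $f$ from $D$ is a surjection from $V(D)$ onto a set $V(F)$; $D/f$ is obtained by identifying each preimage $f^{ -1}(w)$ into a single vertex $w$, keeping the same half-arcs and arcs. For a walk $W$ in $D$, $W/f$ is the walk in $D/f$ with the same half-arcs and each vertex $u$ replaced by $f(u)$. -}

module Defs where

open import Data.Nat using (ℕ; zero; suc; _≤_; _<_)
open import Data.Nat.DivMod using (_mod_)
open import Data.Fin using (Fin; toℕ)
open import Data.Bool using (Bool; true; false; not)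
open import Data.Product using (Σ; ∃; _×_; _,_; proj₁; proj₂)
open import Data.Sum using (_⊎_)
open import Relation.Binary.PropositionalEquality using (_≡_)
open import Function.Bundles using (_↔_; Inverse)

record Digraph : Set where
  field
    n m  : ℕ
    tail : Fin m → Fin n
    head : Fin m → Fin n
open Digraph public

-- Half-arcs: each arc a has two half-arcs,
-- (a , true) at its tail (outgoing) and (a , false) at its head (incoming).
HalfArc : ℕ → Set
HalfArc m = Fin m × Bool

vertOf : (D : Digraph) → HalfArc (m D) → Fin (n D)
vertOf D (a , true)  = tail D a
vertOf D (a , false) = head D a

opp : ∀ {k} → HalfArc k → HalfArc k
opp (a , b) = a , not b

iter : ∀ {A : Set} → (A → A) → ℕ → A → A
iter f zero    x = x
iter f (suc k) x = f (iter f k x)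

next : ∀ {k} → Fin k → Fin k
next {suc k} i = suc (toℕ i) mod suc k

-- D is eulerian: it has a directed closed walk (circuit) using every arc
-- exactly once and every vertex.  With no arcs, the only closed walk is a
-- single vertex, so D must have exactly one vertex.
IsEulerian : Digraph → Set
IsEulerian D =
  (m D ≡ 0 × n D ≡ 1) ⊎
  (0 < m D × Σ (Fin (m D) ↔ Fin (m D)) λ c →
     (∀ i → head D (Inverse.to c i) ≡ tail D (Inverse.to c (next i))) ×
     (∀ v → ∃ λ a → tail D a ≡ v))

SameOrbit : ∀ {A : Set} → (A → A) → A → A → Set
SameOrbit ψ x y = ∃ λ k → iter ψ k x ≡ y

-- Orientable embeddings are given combinatorially by a rotation system:
-- a permutation ρ of the half-arcs whose cycles are exactly the sets of
-- half-arcs at the vertices (the fixed orientation = the cyclic order).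
Rotation : Digraph → Set
Rotation D = HalfArc (m D) ↔ HalfArc (m D)

rot : ∀ {k} → (HalfArc k ↔ HalfArc k) → HalfArc k → HalfArc k
rot R = Inverse.to R

-- face-tracing permutation; faces are the orbits of faceStep
faceStep : ∀ {k} → (HalfArc k ↔ HalfArc k) → HalfArc k → HalfArc k
faceStep R h = rot R (opp h)

-- the face traced from h traverses the arc of each of its half-arcs h'
-- from vertOf h' to vertOf (opp h'); it is a directed walk iff all these
-- half-arcs lie on the same side (all tails, or all heads).
record IsDirEmbedding (D : Digraph) (R : Rotation D) : Set where
  field
    rot-vert : ∀ h → vertOf D (rot R h) ≡ vertOf D h
    rot-cyc  : ∀ h h' → vertOf D h ≡ vertOf D h' → SameOrbit (rot R) h h'
    directed : ∀ h → proj₂ (faceStep R h) ≡ proj₂ h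

-- Face represented by half-arc h is an antiface: its facial walk traverses
-- every arc against the tracing direction (convention: anticlockwise).
Antiface : ∀ {k} → (HalfArc k ↔ HalfArc k) → HalfArc k → Set
Antiface R h = ∀ h' → SameOrbit (faceStep R) h h' → proj₂ h' ≡ false

IncidentWith : (D : Digraph) → Rotation D → HalfArc (m D) → Fin (n D) → Set
IncidentWith D R h v = ∃ λ h' → SameOrbit (faceStep R) h h' × vertOf D h' ≡ v

NumFaces : ∀ {A : Set} → (A → A) → (A → Set) → ℕ → Set
NumFaces {A} ψ P k =
  Σ (Fin k → A) λ r →
    (∀ i → P (r i)) ×
    (∀ i j → SameOrbit ψ (r i) (r j) → i ≡ j) ×
    (∀ x → P x → ∃ λ i → SameOrbit ψ (r i) x)

_/_ : (D : Digraph) → {n' : ℕ} → (Fin (n D) → Fin n') → Digraph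
_/_ D {n'} f = record { n = n' ; m = m D
                      ; tail = λ a → f (tail D a) ; head = λ a → f (head D a) }

IdentifiesThree : ∀ {k k'} → (Fin k → Fin k') → Fin k → Fin k → Fin k → Set
IdentifiesThree f v₁ v₂ v₃ =
  (∀ w → ∃ λ x → f x ≡ w) ×
  (∀ x y → InS x → InS y → f x ≡ f y) ×
  (∀ x y → f x ≡ f y → x ≡ y ⊎ (InS x × InS y))
  where
  InS : _ → Set
  InS x = x ≡ v₁ ⊎ x ≡ v₂ ⊎ x ≡ v₃

-- A rotation ρ of the half-arcs, whose cycles are the vertices, is an orientable embedding with
-- faces the cycles of σ = ρ ∘ opp. Multiplying a permutation by a transposition (a b) merges the
-- cycles of a and b when they differ and splits their common cycle otherwise. Take the head half-arc
-- yᵢ at vᵢ on the antiface Aᵢ and put ρ′ = (c y₃)(y₁ y₂) ρ with c ∈ {y₁, y₂}: as v₁, v₂, v₃ are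
-- distinct, ρ′ merges their rotations into one, so it is a rotation of D/f. Its face permutation is
-- σ′ = (c y₃)(y₁ y₂) σ, which leaves every face avoiding the yᵢ unchanged and regroups the half-arcs
-- of 𝒜, all heads, into antifaces. Taking c off the (y₁ y₂) σ-cycle of y₃ whenever possible, the
-- number of these faces goes 3 → 2 → 1, 2 → 1 → 2 or 2 → 3 → 2, and 1 → 2 → 1.

module Submission where

open import Defs
open import Data.Bool using (Bool; true; false)
open import Data.Bool.Properties using (not-involutive)
open import Data.Empty using (⊥-elim)
open import Data.Fin as Fin using (Fin; toℕ; zero; suc)
import Data.Fin.Properties as Fin
open import Data.Nat using (ℕ; zero; suc; _+_; _*_; _∸_; _≤_; _<_; z≤n; s≤s)
import Data.Nat.Properties as ℕ
open import Data.Nat.DivMod using (_%_; m≡m%n+[m/n]*n; m%n<n) renaming (_/_ to _div_)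
open import Data.Nat.Induction using (<-rec)
open import Data.Product using (Σ; ∃; _×_; _,_; proj₁; proj₂; map₂; uncurry)
open import Data.Sum using (_⊎_; inj₁; inj₂; [_,_]; [_,_]′)
open import Function using (_∘_; id)
open import Function.Bundles using (_↔_; _↣_; Inverse; Injection; mk↔ₛ′; mk↣)
open import Function.Definitions using (Injective)
open import Function.Properties.Inverse using (Inverse⇒Injection)
open import Relation.Binary.Definitions using (DecidableEquality; tri<; tri≈; tri>)
open import Relation.Binary.PropositionalEquality
  using (_≡_; _≢_; refl; sym; trans; cong; subst; subst₂; module ≡-Reasoning)
open import Relation.Nullary using (¬_; Dec; yes; no)
open import Relation.Nullary.Decidable using (via-injection; _⊎-dec_)
open import Relation.Unary using (Decidable)

module _ {A : Set} (f : A → A) where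

  iter-+ : ∀ j k x → iter f (j + k) x ≡ iter f j (iter f k x)
  iter-+ zero    k x = refl
  iter-+ (suc j) k x = cong f (iter-+ j k x)

  iter-suc : ∀ k x → iter f (suc k) x ≡ iter f k (f x)
  iter-suc zero    x = refl
  iter-suc (suc k) x = cong f (iter-suc k x)

  iter-fixed-* : ∀ {q x} → iter f q x ≡ x → ∀ d → iter f (d * q) x ≡ x
  iter-fixed-* e zero = refl
  iter-fixed-* {q} {x} e (suc d) = begin
    iter f (q + d * q) x     ≡⟨ iter-+ q (d * q) x ⟩
    iter f q (iter f (d * q) x) ≡⟨ cong (iter f q) (iter-fixed-* e d) ⟩
    iter f q x               ≡⟨ e ⟩
    x                        ∎
    where open ≡-Reasoning

  iter-injective : Injective _≡_ _≡_ f → ∀ k {x y} → iter f k x ≡ iter f k y → x ≡ y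
  iter-injective f-inj zero    e = e
  iter-injective f-inj (suc k) e = iter-injective f-inj k (f-inj e)

least-witness : ∀ {P : ℕ → Set} → Decidable P → ∀ {k} → P k →
                ∃ λ j → P j × (∀ {i} → i < j → ¬ P i)
least-witness {P} P? {k} = <-rec (λ k → P k → _) search k
  where
  search : ∀ k → (∀ {j} → j < k → P j → ∃ λ j → P j × (∀ {i} → i < j → ¬ P i)) →
           P k → ∃ λ j → P j × (∀ {i} → i < j → ¬ P i)
  search k smaller pk with ℕ.anyUpTo? P? k
  ... | yes (j , j<k , pj) = smaller j<k pj
  ... | no  none           = k , pk , λ i<k pi → none (_ , i<k , pi)

identifiedCount : ℕ → ℕ
identifiedCount 3 = 1
identifiedCount k = k

identifiedCount-≤ : ∀ k → identifiedCount k ≤ k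
identifiedCount-≤ 0                   = z≤n
identifiedCount-≤ 1                   = ℕ.≤-refl
identifiedCount-≤ 2                   = ℕ.≤-refl
identifiedCount-≤ 3                   = s≤s z≤n
identifiedCount-≤ (suc (suc (suc (suc k)))) = ℕ.≤-refl

NumFaces-resp : ∀ {A : Set} {ψ : A → A} {P Q : A → Set} {k} →
                (∀ {x} → P x → Q x) → (∀ {x} → Q x → P x) → NumFaces ψ P k → NumFaces ψ Q k
NumFaces-resp P⇒Q Q⇒P (r , r∈P , distinct , covers) = r , P⇒Q ∘ r∈P , distinct , λ x → covers x ∘ Q⇒P

Among : {A : Set} → A → A → A → A → Set
Among x y z p = p ≡ x ⊎ p ≡ y ⊎ p ≡ z

module Permutations {A : Set} {N : ℕ} (enc : A ↣ Fin N) where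

  _≟_ : DecidableEquality A
  _≟_ = via-injection enc Fin._≟_

  module Orbits (π : A ↔ A) where

    open Inverse π using (to)

    infix 4 _~_ _~?_
    _~_ : A → A → Set
    _~_ = SameOrbit to

    ~-refl : ∀ {x} → x ~ x
    ~-refl = 0 , refl

    ~-step : ∀ x → x ~ to x
    ~-step x = 1 , refl

    ~-trans : ∀ {x y z} → x ~ y → y ~ z → x ~ z
    ~-trans {x} (k , refl) (l , refl) = l + k , iter-+ to l k x

    -- Pigeonhole on the first N + 1 iterates.
    period : ∀ x → ∃ λ p → iter to (suc p) x ≡ x
    period x with Fin.pigeonhole (ℕ.n<1+n N) (λ i → Injection.to enc (iter to (toℕ i) x))
    ... | i , j , i<j , e = d , sym (iter-injective to (Injection.injective (Inverse⇒Injection π)) (toℕ i) same)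
      where
      d = toℕ j ∸ suc (toℕ i)
      same : iter to (toℕ i) x ≡ iter to (toℕ i) (iter to (suc d) x)
      same = begin
        iter to (toℕ i) x                    ≡⟨ Injection.injective enc e ⟩
        iter to (toℕ j) x                    ≡⟨ cong (λ t → iter to t x) (ℕ.m+[n∸m]≡n i<j) ⟨
        iter to (suc (toℕ i) + d) x          ≡⟨ cong (λ t → iter to t x) (ℕ.+-suc (toℕ i) d) ⟨
        iter to (toℕ i + suc d) x            ≡⟨ iter-+ to (toℕ i) (suc d) x ⟩
        iter to (toℕ i) (iter to (suc d) x)  ∎
        where open ≡-Reasoning

    ~-sym : ∀ {x y} → x ~ y → y ~ x
    ~-sym {x} (k , refl) with p , loop ← period x = k * p , (begin
      iter to (k * p) (iter to k x)  ≡⟨ iter-+ to (k * p) k x ⟨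
      iter to (k * p + k) x          ≡⟨ cong (λ t → iter to t x) (ℕ.+-comm (k * p) k) ⟩
      iter to (k + k * p) x          ≡⟨ cong (λ t → iter to t x) (ℕ.*-suc k p) ⟨
      iter to (k * suc p) x          ≡⟨ iter-fixed-* to loop k ⟩
      x                              ∎)
      where open ≡-Reasoning

    ~-both : ∀ {x y z} → y ~ z → x ~ y ⊎ x ~ z → x ~ y × x ~ z
    ~-both y~z (inj₁ x~y) = x~y , ~-trans x~y y~z
    ~-both y~z (inj₂ x~z) = ~-trans x~z (~-sym y~z) , x~z

    ~-positive : ∀ {x y} → x ~ y → ∃ λ k → iter to (suc k) x ≡ y
    ~-positive {x} (k , refl) with p , loop ← period (iter to k x) =
      p + k , trans (iter-+ to (suc p) k x) loop

    _~?_ : ∀ x y → Dec (x ~ y)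
    x ~? y with p , loop ← period x with ℕ.anyUpTo? (λ i → iter to i x ≟ y) (suc p)
    ... | yes (i , _ , e) = yes (i , e)
    ... | no none = no λ (k , e) → none (k % suc p , m%n<n k (suc p) , trans (sym (reduce k)) e)
      where
      reduce : ∀ k → iter to k x ≡ iter to (k % suc p) x
      reduce k = begin
        iter to k x                                       ≡⟨ cong (λ t → iter to t x) (m≡m%n+[m/n]*n k (suc p)) ⟩
        iter to (k % suc p + q * suc p) x                 ≡⟨ iter-+ to (k % suc p) (q * suc p) x ⟩
        iter to (k % suc p) (iter to (q * suc p) x)       ≡⟨ cong (iter to (k % suc p)) (iter-fixed-* to loop q) ⟩
        iter to (k % suc p) x                             ∎
        where
        q = k div suc p
        open ≡-Reasoning

    NumFaces-≤ : ∀ {P : A → Set} {k k′} → NumFaces to P k → NumFaces to P k′ → k ≤ k′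
    NumFaces-≤ (r , r∈P , distinct , _) (r′ , _ , _ , covers′) = Fin.injective⇒≤ face-injective
      where
      face : ∀ i → ∃ λ i′ → r′ i′ ~ r i
      face i = covers′ (r i) (r∈P i)
      face-injective : Injective _≡_ _≡_ (proj₁ ∘ face)
      face-injective {i} {j} e = distinct i j
        (~-trans (~-sym (proj₂ (face i))) (subst (λ i′ → r′ i′ ~ r j) (sym e) (proj₂ (face j))))

    NumFaces-unique : ∀ {P : A → Set} {k k′} → NumFaces to P k → NumFaces to P k′ → k ≡ k′
    NumFaces-unique nf nf′ = ℕ.≤-antisym (NumFaces-≤ nf nf′) (NumFaces-≤ nf′ nf)

    InOrbits : A → A → A → A → Set
    InOrbits x y z w = x ~ w ⊎ y ~ w ⊎ z ~ w

    module _ {x y z : A} where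

      among-orbit : ∀ {p w} → Among x y z p → p ~ w → InOrbits x y z w
      among-orbit (inj₁ refl)        = inj₁
      among-orbit (inj₂ (inj₁ refl)) = inj₂ ∘ inj₁
      among-orbit (inj₂ (inj₂ refl)) = inj₂ ∘ inj₂

      InOrbits-elim : ∀ {w} → InOrbits x y z w → ∃ λ p → Among x y z p × p ~ w
      InOrbits-elim (inj₁ x~w)        = x , inj₁ refl , x~w
      InOrbits-elim (inj₂ (inj₁ y~w)) = y , inj₂ (inj₁ refl) , y~w
      InOrbits-elim (inj₂ (inj₂ z~w)) = z , inj₂ (inj₂ refl) , z~w

      InOrbits-resp : ∀ {x′ y′ z′ w} → x′ ~ x → y′ ~ y → z′ ~ z → InOrbits x y z w → InOrbits x′ y′ z′ w
      InOrbits-resp x′~x y′~y z′~z = Data.Sum.map (~-trans x′~x) (Data.Sum.map (~-trans y′~y) (~-trans z′~z))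

      InOrbits-closed : ∀ {w w′} → InOrbits x y z w → w ~ w′ → InOrbits x y z w′
      InOrbits-closed w∈ w~w′ with p , p∈ , p~w ← InOrbits-elim w∈ = among-orbit p∈ (~-trans p~w w~w′)

      one-orbit : x ~ y → x ~ z → NumFaces to (InOrbits x y z) 1
      one-orbit x~y x~z = (λ _ → x) , (λ _ → inj₁ ~-refl) , (λ { zero zero _ → refl }) , covers
        where
        covers : ∀ w → InOrbits x y z w → ∃ λ i → x ~ w
        covers w (inj₁ x~w)        = zero , x~w
        covers w (inj₂ (inj₁ y~w)) = zero , ~-trans x~y y~w
        covers w (inj₂ (inj₂ z~w)) = zero , ~-trans x~z z~w

      two-orbits : ¬ x ~ y → z ~ x ⊎ z ~ y → NumFaces to (InOrbits x y z) 2
      two-orbits x≁y z~x∨y = r , r∈ , distinct , covers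
        where
        r : Fin 2 → A
        r zero    = x
        r (suc _) = y
        r∈ : ∀ i → InOrbits x y z (r i)
        r∈ zero       = inj₁ ~-refl
        r∈ (suc zero) = inj₂ (inj₁ ~-refl)
        distinct : ∀ i j → r i ~ r j → i ≡ j
        distinct zero       zero       _   = refl
        distinct zero       (suc zero) x~y = ⊥-elim (x≁y x~y)
        distinct (suc zero) zero       y~x = ⊥-elim (x≁y (~-sym y~x))
        distinct (suc zero) (suc zero) _   = refl
        covers : ∀ w → InOrbits x y z w → ∃ λ i → r i ~ w
        covers w (inj₁ x~w)        = zero , x~w
        covers w (inj₂ (inj₁ y~w)) = suc zero , y~w
        covers w (inj₂ (inj₂ z~w)) =
          [ (λ z~x → zero , ~-trans (~-sym z~x) z~w) , (λ z~y → suc zero , ~-trans (~-sym z~y) z~w) ]′ z~x∨y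

      three-orbits : ¬ x ~ y → ¬ x ~ z → ¬ y ~ z → NumFaces to (InOrbits x y z) 3
      three-orbits x≁y x≁z y≁z = r , r∈ , distinct , covers
        where
        r : Fin 3 → A
        r zero          = x
        r (suc zero)    = y
        r (suc (suc _)) = z
        r∈ : ∀ i → InOrbits x y z (r i)
        r∈ zero             = inj₁ ~-refl
        r∈ (suc zero)       = inj₂ (inj₁ ~-refl)
        r∈ (suc (suc zero)) = inj₂ (inj₂ ~-refl)
        distinct-< : ∀ {i j} → toℕ i < toℕ j → ¬ r i ~ r j
        distinct-< {zero}     {suc zero}       _ = x≁y
        distinct-< {zero}     {suc (suc zero)} _ = x≁z
        distinct-< {suc zero} {suc (suc zero)} _ = y≁z
        distinct-< {suc _}    {suc zero}       (s≤s ())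
        distinct-< {suc (suc _)} {suc (suc zero)} (s≤s (s≤s ()))
        distinct : ∀ i j → r i ~ r j → i ≡ j
        distinct i j ri~rj with ℕ.<-cmp (toℕ i) (toℕ j)
        ... | tri< i<j _ _ = ⊥-elim (distinct-< i<j ri~rj)
        ... | tri≈ _ i≡j _ = Fin.toℕ-injective i≡j
        ... | tri> _ _ j<i = ⊥-elim (distinct-< j<i (~-sym ri~rj))
        covers : ∀ w → InOrbits x y z w → ∃ λ i → r i ~ w
        covers w (inj₁ x~w)        = zero , x~w
        covers w (inj₂ (inj₁ y~w)) = suc zero , y~w
        covers w (inj₂ (inj₂ z~w)) = suc (suc zero) , z~w

    NumFaces-rotate : ∀ {x y z k} → NumFaces to (InOrbits y z x) k → NumFaces to (InOrbits x y z) k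
    NumFaces-rotate = NumFaces-resp [ inj₂ ∘ inj₁ , [ inj₂ ∘ inj₂ , inj₁ ] ]
                                    [ inj₂ ∘ inj₂ , [ inj₁ , inj₂ ∘ inj₁ ] ]

    NumFaces-swap : ∀ {x y z k} → NumFaces to (InOrbits x z y) k → NumFaces to (InOrbits x y z) k
    NumFaces-swap = NumFaces-resp [ inj₁ , [ inj₂ ∘ inj₂ , inj₂ ∘ inj₁ ] ]
                                  [ inj₁ , [ inj₂ ∘ inj₂ , inj₂ ∘ inj₁ ] ]

  swap : A → A → A → A
  swap a b x with x ≟ a
  ... | yes _ = b
  ... | no _ with x ≟ b
  ...   | yes _ = a
  ...   | no _  = x

  data SwapView (a b x : A) : A → Set where
    at-a      : x ≡ a → SwapView a b x b
    at-b      : x ≡ b → SwapView a b x a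
    elsewhere : x ≢ a → x ≢ b → SwapView a b x x

  swap-view : ∀ a b x → SwapView a b x (swap a b x)
  swap-view a b x with x ≟ a
  ... | yes x≡a = at-a x≡a
  ... | no  x≢a with x ≟ b
  ...   | yes x≡b = at-b x≡b
  ...   | no  x≢b = elsewhere x≢a x≢b

  module _ {a b : A} where

    swap-preserves : ∀ (P : A → Set) {x} → P a → P b → P x → P (swap a b x)
    swap-preserves P {x} pa pb px with swap a b x | swap-view a b x
    ... | _ | at-a _        = pb
    ... | _ | at-b _        = pa
    ... | _ | elsewhere _ _ = px

    swap-resp : ∀ {B : Set} (g : A → B) {x} → g a ≡ g b → g (swap a b x) ≡ g x
    swap-resp g {x} ga≡gb with swap a b x | swap-view a b x
    ... | _ | at-a refl     = sym ga≡gb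
    ... | _ | at-b refl     = ga≡gb
    ... | _ | elsewhere _ _ = refl

    swap-a : swap a b a ≡ b
    swap-a with swap a b a | swap-view a b a
    ... | _ | at-a _          = refl
    ... | _ | at-b a≡b        = a≡b
    ... | _ | elsewhere a≢a _ = ⊥-elim (a≢a refl)

    swap-b : swap a b b ≡ a
    swap-b with swap a b b | swap-view a b b
    ... | _ | at-a b≡a        = b≡a
    ... | _ | at-b _          = refl
    ... | _ | elsewhere _ b≢b = ⊥-elim (b≢b refl)

    swap-other : ∀ {x} → x ≢ a → x ≢ b → swap a b x ≡ x
    swap-other {x} x≢a x≢b with swap a b x | swap-view a b x
    ... | _ | at-a x≡a      = ⊥-elim (x≢a x≡a)
    ... | _ | at-b x≡b      = ⊥-elim (x≢b x≡b)
    ... | _ | elsewhere _ _ = refl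

    swap-involutive : ∀ x → swap a b (swap a b x) ≡ x
    swap-involutive x with swap a b x | swap-view a b x
    ... | _ | at-a refl         = swap-b
    ... | _ | at-b refl         = swap-a
    ... | _ | elsewhere x≢a x≢b = swap-other x≢a x≢b

  transpose : A → A → A ↔ A → A ↔ A
  transpose a b π = mk↔ₛ′ (swap a b ∘ to) (from ∘ swap a b)
    (λ x → trans (cong (swap a b) (strictlyInverseˡ (swap a b x))) (swap-involutive x))
    (λ x → trans (cong from (swap-involutive (to x))) (strictlyInverseʳ x))
    where open Inverse π

  module Transposition (π : A ↔ A) (a b : A) where

    private
      module O  = Orbits π
      module O′ = Orbits (transpose a b π)
      open Inverse π using (to)
      to′ = Inverse.to (transpose a b π)

    open O using (_~_)
    open O′ using () renaming (_~_ to _~′_)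

    Touched : A → Set
    Touched x = x ~ a ⊎ x ~ b

    touched? : Decidable Touched
    touched? x = (x O.~? a) ⊎-dec (x O.~? b)

    touched-resp : ∀ {x y} → x ~ y → Touched y → Touched x
    touched-resp x~y = Data.Sum.map (O.~-trans x~y) (O.~-trans x~y)

    agrees-outside : ∀ {x} → ¬ Touched x → to′ x ≡ to x
    agrees-outside ¬tx = swap-other (λ e → ¬tx (inj₁ (1 , e))) (λ e → ¬tx (inj₂ (1 , e)))

    untouched-iter : ∀ k {x} → ¬ Touched x → iter to′ k x ≡ iter to k x
    untouched-iter zero    ¬tx = refl
    untouched-iter (suc k) ¬tx =
      trans (cong to′ (untouched-iter k ¬tx)) (agrees-outside (¬tx ∘ touched-resp (k , refl)))

    touched-iter′ : ∀ k {x} → Touched x → Touched (iter to′ k x)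
    touched-iter′ zero    tx = tx
    touched-iter′ (suc k) tx = swap-preserves Touched (inj₁ O.~-refl) (inj₂ O.~-refl)
      (touched-resp (O.~-sym (O.~-step _)) (touched-iter′ k tx))

    orbit′-cases : ∀ {x y} → x ~′ y → x ~ y ⊎ (Touched x × Touched y)
    orbit′-cases {x} (k , refl) with touched? x
    ... | yes tx  = inj₂ (tx , touched-iter′ k tx)
    ... | no  ¬tx = inj₁ (k , sym (untouched-iter k ¬tx))

    untouched-orbit : ∀ {x y} → ¬ Touched x → x ~ y → x ~′ y
    untouched-orbit ¬tx (k , refl) = k , untouched-iter k ¬tx

    orbit′-touched : ∀ {x y} → x ~′ y → Touched y → Touched x
    orbit′-touched x~′y ty with orbit′-cases x~′y
    ... | inj₁ x~y       = touched-resp x~y ty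
    ... | inj₂ (tx , _) = tx

    private
      IsAB : A → Set
      IsAB z = z ≡ a ⊎ z ≡ b

    -- Follow π from x until it first enters {a, b}; up to that point π′ agrees with π.
    first-touch : ∀ k {x} → IsAB (iter to (suc k) x) → (x ~ a × x ~′ b) ⊎ (x ~ b × x ~′ a)
    first-touch k {x} hit with to x ≟ a | to x ≟ b
    ... | yes πx≡a | _        = inj₁ ((1 , πx≡a) , (1 , trans (cong (swap a b) πx≡a) swap-a))
    ... | no _     | yes πx≡b = inj₂ ((1 , πx≡b) , (1 , trans (cong (swap a b) πx≡b) swap-b))
    ... | no πx≢a  | no πx≢b  = continue k hit
      where
      step : x ~′ to x
      step = 1 , swap-other πx≢a πx≢b
      continue : ∀ k → IsAB (iter to (suc k) x) → (x ~ a × x ~′ b) ⊎ (x ~ b × x ~′ a)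
      continue zero    (inj₁ πx≡a) = ⊥-elim (πx≢a πx≡a)
      continue zero    (inj₂ πx≡b) = ⊥-elim (πx≢b πx≡b)
      continue (suc k) hit′ = Data.Sum.map back back (first-touch k (subst IsAB (iter-suc to (suc k) x) hit′))
        where
        back : ∀ {u v} → to x ~ u × to x ~′ v → x ~ u × x ~′ v
        back = Data.Product.map (O.~-trans (O.~-step x)) (O′.~-trans step)

    private
      touched⇒hits : ∀ {x} → Touched x → ∃ λ k → IsAB (iter to (suc k) x)
      touched⇒hits (inj₁ x~a) = map₂ inj₁ (O.~-positive x~a)
      touched⇒hits (inj₂ x~b) = map₂ inj₂ (O.~-positive x~b)

    touched⇒orbit′ : ∀ {x} → Touched x → x ~′ a ⊎ x ~′ b
    touched⇒orbit′ tx with k , hit ← touched⇒hits tx =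
      Data.Sum.swap (Data.Sum.map proj₂ proj₂ (first-touch k hit))

    merge : ¬ a ~ b → a ~′ b
    merge a≁b with k , loop ← O.~-positive (O.~-refl {a}) with first-touch k (inj₁ loop)
    ... | inj₁ (_ , a~′b) = a~′b
    ... | inj₂ (a~b , _)  = ⊥-elim (a≁b a~b)

    orbits-merge : ¬ a ~ b → ∀ {x y} → x ~ y ⊎ (Touched x × Touched y) → x ~′ y
    orbits-merge a≁b {x} (inj₁ x~y) with touched? x
    ... | no  ¬tx = untouched-orbit ¬tx x~y
    ... | yes tx  = orbits-merge a≁b (inj₂ (tx , touched-resp (O.~-sym x~y) tx))
    orbits-merge a≁b (inj₂ (tx , ty)) = O′.~-trans (toward-a tx) (O′.~-sym (toward-a ty))
      where
      toward-a : ∀ {z} → Touched z → z ~′ a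
      toward-a tz = [ id , (λ z~′b → O′.~-trans z~′b (O′.~-sym (merge a≁b))) ] (touched⇒orbit′ tz)

    -- The π′-orbit of a is the arc a, π a, …, π⁻¹ b of its π-cycle, which misses b.
    split : a ~ b → a ≢ b → ¬ a ~′ b
    split a~b a≢b (l , π′ˡa≡b) with least-witness (λ j → iter to j a ≟ b) {proj₁ a~b} (proj₂ a~b)
    ... | k , πᵏa≡b , misses-b = misses-b (proj₁ (proj₂ (segment l))) (trans (proj₂ (proj₂ (segment l))) π′ˡa≡b)
      where
      Segment : A → Set
      Segment x = ∃ λ j → j < k × iter to j a ≡ x

      0<k : 0 < k
      0<k = ℕ.n≢0⇒n>0 λ k≡0 → a≢b (subst (λ t → iter to t a ≡ b) k≡0 πᵏa≡b)

      no-return : ∀ {j} → suc j < k → iter to (suc j) a ≢ a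
      no-return {j} j<k πʲa≡a = misses-b (ℕ.∸-monoʳ-< {k} (s≤s z≤n) (ℕ.<⇒≤ j<k)) (begin
        iter to (k ∸ suc j) a                       ≡⟨ cong (iter to (k ∸ suc j)) πʲa≡a ⟨
        iter to (k ∸ suc j) (iter to (suc j) a)     ≡⟨ iter-+ to (k ∸ suc j) (suc j) a ⟨
        iter to (k ∸ suc j + suc j) a               ≡⟨ cong (λ t → iter to t a) (ℕ.m∸n+n≡m (ℕ.<⇒≤ j<k)) ⟩
        iter to k a                                 ≡⟨ πᵏa≡b ⟩
        b                                           ∎)
        where open ≡-Reasoning

      closed : ∀ {x} → Segment x → Segment (to′ x)
      closed (j , j<k , refl) with ℕ.m≤n⇒m<n∨m≡n j<k
      ... | inj₂ refl  = 0 , 0<k , sym (trans (cong (swap a b) πᵏa≡b) swap-b)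
      ... | inj₁ 1+j<k = suc j , 1+j<k , sym (swap-other (no-return 1+j<k) (misses-b 1+j<k))

      segment : ∀ t → Segment (iter to′ t a)
      segment zero    = 0 , 0<k , refl
      segment (suc t) = closed (segment t)

    module _ {x y z : A} (a∈ : Among x y z a) (b∈ : Among x y z b) where

      InOrbits′⇒InOrbits : ∀ {w} → O′.InOrbits x y z w → O.InOrbits x y z w
      InOrbits′⇒InOrbits w∈ with p , p∈ , p~′w ← O′.InOrbits-elim w∈ with orbit′-cases p~′w
      ... | inj₁ p~w              = O.among-orbit p∈ p~w
      ... | inj₂ (_ , inj₁ w~a) = O.among-orbit a∈ (O.~-sym w~a)
      ... | inj₂ (_ , inj₂ w~b) = O.among-orbit b∈ (O.~-sym w~b)

      InOrbits⇒InOrbits′ : ∀ {w} → O.InOrbits x y z w → O′.InOrbits x y z w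
      InOrbits⇒InOrbits′ {w} w∈ with p , p∈ , p~w ← O.InOrbits-elim w∈ with touched? w
      ... | no ¬tw = O′.among-orbit p∈ (O′.~-sym (untouched-orbit ¬tw (O.~-sym p~w)))
      ... | yes tw with touched⇒orbit′ tw
      ...   | inj₁ w~′a = O′.among-orbit a∈ (O′.~-sym w~′a)
      ...   | inj₂ w~′b = O′.among-orbit b∈ (O′.~-sym w~′b)

  identified-count-clauses : ∀ (σ σ′ : A ↔ A) {P : A → Set} {k} →
    NumFaces (Inverse.to σ) P k → NumFaces (Inverse.to σ′) P (identifiedCount k) →
    (NumFaces (Inverse.to σ) P 3 → NumFaces (Inverse.to σ′) P 1) ×
    (NumFaces (Inverse.to σ) P 2 → NumFaces (Inverse.to σ′) P 2) ×
    (NumFaces (Inverse.to σ) P 1 → NumFaces (Inverse.to σ′) P 1) ×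
    (∀ k k′ → NumFaces (Inverse.to σ) P k → NumFaces (Inverse.to σ′) P k′ → k′ ≤ k)
  identified-count-clauses σ σ′ {P} before after = count 3 , count 2 , count 1 , bound
    where
    count : ∀ j → NumFaces (Inverse.to σ) P j → NumFaces (Inverse.to σ′) P (identifiedCount j)
    count j nf = subst (NumFaces (Inverse.to σ′) P ∘ identifiedCount) (Orbits.NumFaces-unique σ before nf) after
    bound : ∀ k k′ → NumFaces (Inverse.to σ) P k → NumFaces (Inverse.to σ′) P k′ → k′ ≤ k
    bound k k′ nf nf′ = subst₂ _≤_ (Orbits.NumFaces-unique σ′ after nf′) (Orbits.NumFaces-unique σ before nf)
                                   (identifiedCount-≤ _)

  module IdentifiedFaces (σ : A ↔ A) (y₁ y₂ y₃ : A) (y₁≢y₂ : y₁ ≢ y₂) (y₂≢y₃ : y₂ ≢ y₃) where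

    σ₁ : A ↔ A
    σ₁ = transpose y₁ y₂ σ

    private
      module O  = Orbits σ
      module O₁ = Orbits σ₁
      module T₁ = Transposition σ y₁ y₂
      open O using (_~_; _~?_)
      open O₁ using () renaming (_~_ to _~₁_)

    module SecondTransposition (c : A) (c∈ : c ≡ y₁ ⊎ c ≡ y₂) where

      σ′ : A ↔ A
      σ′ = transpose c y₃ σ₁

      module O′ = Orbits σ′
      module T₂ = Transposition σ₁ c y₃

      private
        y₁∈ : Among y₁ y₂ y₃ y₁
        y₁∈ = inj₁ refl
        y₂∈ : Among y₁ y₂ y₃ y₂
        y₂∈ = inj₂ (inj₁ refl)
        y₃∈ : Among y₁ y₂ y₃ y₃
        y₃∈ = inj₂ (inj₂ refl)
        c∈′ : Among y₁ y₂ y₃ c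
        c∈′ = [ inj₁ , inj₂ ∘ inj₁ ]′ c∈

      InOrbits⇒InOrbits′ : ∀ {w} → O.InOrbits y₁ y₂ y₃ w → O′.InOrbits y₁ y₂ y₃ w
      InOrbits⇒InOrbits′ = T₂.InOrbits⇒InOrbits′ c∈′ y₃∈ ∘ T₁.InOrbits⇒InOrbits′ y₁∈ y₂∈

      InOrbits′⇒InOrbits : ∀ {w} → O′.InOrbits y₁ y₂ y₃ w → O.InOrbits y₁ y₂ y₃ w
      InOrbits′⇒InOrbits = T₁.InOrbits′⇒InOrbits y₁∈ y₂∈ ∘ T₂.InOrbits′⇒InOrbits c∈′ y₃∈

      InOrbits-closed′ : ∀ {w w′} → O.InOrbits y₁ y₂ y₃ w → w O′.~ w′ → O.InOrbits y₁ y₂ y₃ w′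
      InOrbits-closed′ w∈ w~′w′ = InOrbits′⇒InOrbits (O′.InOrbits-closed (InOrbits⇒InOrbits′ w∈) w~′w′)

      agrees-outside : ∀ {w} → ¬ O.InOrbits y₁ y₂ y₃ w → Inverse.to σ′ w ≡ Inverse.to σ w
      agrees-outside w∉ = trans (T₂.agrees-outside ¬touched₂) (T₁.agrees-outside ¬touched₁)
        where
        ¬touched₁ = w∉ ∘ [ O.among-orbit y₁∈ ∘ O.~-sym , O.among-orbit y₂∈ ∘ O.~-sym ]′
        ¬touched₂ = w∉ ∘ T₁.InOrbits′⇒InOrbits y₁∈ y₂∈
                      ∘ [ O₁.among-orbit c∈′ ∘ O₁.~-sym , O₁.among-orbit y₃∈ ∘ O₁.~-sym ]′

      NumFaces-InOrbits′ : ∀ {k} → NumFaces (Inverse.to σ′) (O′.InOrbits y₁ y₂ y₃) k →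
                NumFaces (Inverse.to σ′) (O.InOrbits y₁ y₂ y₃) k
      NumFaces-InOrbits′ = NumFaces-resp InOrbits′⇒InOrbits InOrbits⇒InOrbits′

      FaceCounts : Set
      FaceCounts = ∃ λ k → NumFaces (Inverse.to σ) (O.InOrbits y₁ y₂ y₃) k ×
                           NumFaces (Inverse.to σ′) (O.InOrbits y₁ y₂ y₃) (identifiedCount k)

    identified-faces-y₂ : y₃ ~₁ y₁ → SecondTransposition.FaceCounts y₂ (inj₂ refl)
    identified-faces-y₂ y₃~₁y₁ = cases (y₁ ~? y₂)
      where
      open SecondTransposition y₂ (inj₂ refl)
      cases : Dec (y₁ ~ y₂) → FaceCounts
      cases (yes y₁~y₂) =
        1 , O.one-orbit y₁~y₂ y₁~y₃ , NumFaces-InOrbits′ (uncurry O′.one-orbit (O′.~-both y₂~′y₃ y₁~′y₂∨y₃))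
        where
        y₁~y₃ : y₁ ~ y₃
        y₁~y₃ = O.~-sym (proj₁ (O.~-both y₁~y₂ (T₁.orbit′-touched y₃~₁y₁ (inj₁ O.~-refl))))
        y₂~′y₃ : y₂ O′.~ y₃
        y₂~′y₃ = T₂.merge λ y₂~₁y₃ → T₁.split y₁~y₂ y₁≢y₂ (O₁.~-sym (O₁.~-trans y₂~₁y₃ y₃~₁y₁))
        y₁~′y₂∨y₃ : y₁ O′.~ y₂ ⊎ y₁ O′.~ y₃
        y₁~′y₂∨y₃ = T₂.touched⇒orbit′ (inj₂ (O₁.~-sym y₃~₁y₁))
      cases (no y₁≁y₂) =
        2 , O.two-orbits y₁≁y₂ (T₁.orbit′-touched y₃~₁y₁ (inj₁ O.~-refl)) ,
        NumFaces-InOrbits′ (O′.NumFaces-rotate (O′.two-orbits y₂≁′y₃ (T₂.touched⇒orbit′ (inj₁ y₁~₁y₂))))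
        where
        y₁~₁y₂ : y₁ ~₁ y₂
        y₁~₁y₂ = T₁.merge y₁≁y₂
        y₂≁′y₃ : ¬ y₂ O′.~ y₃
        y₂≁′y₃ = T₂.split (O₁.~-sym (O₁.~-trans y₃~₁y₁ y₁~₁y₂)) y₂≢y₃

    identified-faces-y₁ : ¬ y₃ ~₁ y₁ → SecondTransposition.FaceCounts y₁ (inj₁ refl)
    identified-faces-y₁ y₃≁₁y₁ = cases (y₁ ~? y₂) (y₃ ~? y₁)
      where
      open SecondTransposition y₁ (inj₁ refl)
      y₁~′y₃ : y₁ O′.~ y₃
      y₁~′y₃ = T₂.merge (y₃≁₁y₁ ∘ O₁.~-sym)
      cases : Dec (y₁ ~ y₂) → Dec (y₃ ~ y₁) → FaceCounts
      cases (no y₁≁y₂) _ =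
        3 , O.three-orbits y₁≁y₂ y₁≁y₃ y₂≁y₃ , NumFaces-InOrbits′ (O′.one-orbit y₁~′y₂ y₁~′y₃)
        where
        y₁≁y₃ : ¬ y₁ ~ y₃
        y₁≁y₃ y₁~y₃ = y₃≁₁y₁ (T₁.orbits-merge y₁≁y₂ (inj₁ (O.~-sym y₁~y₃)))
        y₂≁y₃ : ¬ y₂ ~ y₃
        y₂≁y₃ y₂~y₃ = y₃≁₁y₁ (T₁.orbits-merge y₁≁y₂ (inj₂ (inj₂ (O.~-sym y₂~y₃) , inj₁ O.~-refl)))
        y₁~′y₂ : y₁ O′.~ y₂
        y₁~′y₂ = T₂.orbits-merge (y₃≁₁y₁ ∘ O₁.~-sym) (inj₁ (T₁.merge y₁≁y₂))
      cases (yes y₁~y₂) (yes y₃~y₁) =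
        1 , O.one-orbit y₁~y₂ (O.~-sym y₃~y₁) ,
        NumFaces-InOrbits′ (O′.one-orbit (O′.~-sym (proj₁ y₂~′y₁∧y₃)) y₁~′y₃)
        where
        y₂~₁y₃ : y₂ ~₁ y₃
        y₂~₁y₃ = O₁.~-sym ([ (λ y₃~₁y₁ → ⊥-elim (y₃≁₁y₁ y₃~₁y₁)) , id ]′ (T₁.touched⇒orbit′ (inj₁ y₃~y₁)))
        y₂~′y₁∧y₃ : y₂ O′.~ y₁ × y₂ O′.~ y₃
        y₂~′y₁∧y₃ = O′.~-both y₁~′y₃ (T₂.touched⇒orbit′ (inj₂ y₂~₁y₃))
      cases (yes y₁~y₂) (no y₃≁y₁) =
        2 , O.NumFaces-swap (O.two-orbits (y₃≁y₁ ∘ O.~-sym) (inj₁ (O.~-sym y₁~y₂))) ,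
        NumFaces-InOrbits′ (O′.two-orbits y₁≁′y₂ (inj₁ (O′.~-sym y₁~′y₃)))
        where
        y₁≁′y₂ : ¬ y₁ O′.~ y₂
        y₁≁′y₂ y₁~′y₂ with T₂.orbit′-cases y₁~′y₂
        ... | inj₁ y₁~₁y₂            = T₁.split y₁~y₂ y₁≢y₂ y₁~₁y₂
        ... | inj₂ (_ , inj₁ y₂~₁y₁) = T₁.split y₁~y₂ y₁≢y₂ (O₁.~-sym y₂~₁y₁)
        ... | inj₂ (_ , inj₂ y₂~₁y₃) =
          y₃≁y₁ (proj₁ (O.~-both y₁~y₂ (T₁.orbit′-touched (O₁.~-sym y₂~₁y₃) (inj₂ O.~-refl))))

    identified-faces : ∃ λ c → Σ (c ≡ y₁ ⊎ c ≡ y₂) (SecondTransposition.FaceCounts c)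
    identified-faces with y₃ O₁.~? y₁
    ... | yes y₃~₁y₁ = y₂ , inj₂ refl , identified-faces-y₂ y₃~₁y₁
    ... | no  y₃≁₁y₁ = y₁ , inj₁ refl , identified-faces-y₁ y₃≁₁y₁

HalfArc↣ : ∀ {m} → HalfArc m ↣ Fin (m * 2)
HalfArc↣ = mk↣ {to = λ (a , s) → Fin.combine a (bit s)} injective
  where
  bit : Bool → Fin 2
  bit true  = zero
  bit false = suc zero
  bit-injective : Injective _≡_ _≡_ bit
  bit-injective {true}  {true}  _ = refl
  bit-injective {false} {false} _ = refl
  injective : Injective _≡_ _≡_ (λ (a , s) → Fin.combine a (bit s))
  injective {a , s} {b , t} e with refl , s≡t ← Fin.combine-injective a (bit s) b (bit t) e =
    cong (a ,_) (bit-injective s≡t)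

module HalfArcPermutations {m : ℕ} = Permutations (HalfArc↣ {m})
open HalfArcPermutations

opp-involutive : ∀ {k} (h : HalfArc k) → opp (opp h) ≡ h
opp-involutive (a , s) = cong (a ,_) (not-involutive s)

faceStep↔ : ∀ {k} → (HalfArc k ↔ HalfArc k) → HalfArc k ↔ HalfArc k
faceStep↔ R = mk↔ₛ′ (faceStep R) (opp ∘ from)
  (λ h → trans (cong to (opp-involutive (from h))) (strictlyInverseˡ h))
  (λ h → trans (cong opp (strictlyInverseʳ (opp h))) (opp-involutive h))
  where open Inverse R

vertOf-/ : ∀ (D : Digraph) {n′} (φ : Fin (n D) → Fin n′) h → vertOf (D / φ) h ≡ φ (vertOf D h)
vertOf-/ D φ (a , true)  = refl
vertOf-/ D φ (a , false) = refl

vertOf-distinct : ∀ (D : Digraph) {x y : HalfArc (m D)} {u w} → vertOf D x ≡ u → vertOf D y ≡ w → u ≢ w → x ≢ y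
vertOf-distinct D x∈u y∈w u≢w refl = u≢w (trans (sym x∈u) y∈w)

module VertexIdentification
  (D : Digraph) (R : Rotation D) (emb : IsDirEmbedding D R)
  {n′ : ℕ} (φ : Fin (n D) → Fin n′) {v₁ v₂ v₃ : Fin (n D)}
  (v₁≢v₂ : v₁ ≢ v₂) (v₁≢v₃ : v₁ ≢ v₃) (v₂≢v₃ : v₂ ≢ v₃) (identifies : IdentifiesThree φ v₁ v₂ v₃)
  {y₁ y₂ y₃ : HalfArc (m D)} (y₁∈v₁ : vertOf D y₁ ≡ v₁) (y₂∈v₂ : vertOf D y₂ ≡ v₂) (y₃∈v₃ : vertOf D y₃ ≡ v₃)
  (y₁-head : proj₂ y₁ ≡ false) (y₂-head : proj₂ y₂ ≡ false) (y₃-head : proj₂ y₃ ≡ false)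
  where

  open IsDirEmbedding emb

  private
    module ρ  = Orbits R
    module ρ₁ = Orbits (transpose y₁ y₂ R)
    module T₁ = Transposition R y₁ y₂
    open ρ using (_~_)
    open ρ₁ using () renaming (_~_ to _~₁_)

  orbit⇒vertex : ∀ {x y} → x ~ y → vertOf D x ≡ vertOf D y
  orbit⇒vertex {x} (k , refl) = sym (stays k)
    where
    stays : ∀ k → vertOf D (iter (rot R) k x) ≡ vertOf D x
    stays zero    = refl
    stays (suc k) = trans (rot-vert _) (stays k)

  orbit-same-vertex : ∀ {x y u w} → x ~ y → vertOf D x ≡ u → vertOf D y ≡ w → u ≡ w
  orbit-same-vertex x~y x∈u y∈w = trans (sym x∈u) (trans (orbit⇒vertex x~y) y∈w)

  y₁≁y₂ : ¬ y₁ ~ y₂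
  y₁≁y₂ y₁~y₂ = v₁≢v₂ (orbit-same-vertex y₁~y₂ y₁∈v₁ y₂∈v₂)

  y₃-untouched : ¬ T₁.Touched y₃
  y₃-untouched (inj₁ y₃~y₁) = v₁≢v₃ (orbit-same-vertex (ρ.~-sym y₃~y₁) y₁∈v₁ y₃∈v₃)
  y₃-untouched (inj₂ y₃~y₂) = v₂≢v₃ (orbit-same-vertex (ρ.~-sym y₃~y₂) y₂∈v₂ y₃∈v₃)

  module _ {c : HalfArc (m D)} (c∈ : c ≡ y₁ ⊎ c ≡ y₂) where

    private
      module T₂ = Transposition (transpose y₁ y₂ R) c y₃

    R′ : Rotation (D / φ)
    R′ = transpose c y₃ (transpose y₁ y₂ R)

    c-touched : T₁.Touched c
    c-touched = [ (λ { refl → inj₁ ρ.~-refl }) , (λ { refl → inj₂ ρ.~-refl }) ]′ c∈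

    c≁₁y₃ : ¬ c ~₁ y₃
    c≁₁y₃ c~₁y₃ = y₃-untouched (T₁.orbit′-touched (ρ₁.~-sym c~₁y₃) c-touched)

    identified-touched : ∀ {x} → Among v₁ v₂ v₃ (vertOf D x) → T₂.Touched x
    identified-touched {x} (inj₁ x∈v₁) =
      inj₁ (T₁.orbits-merge y₁≁y₂ (inj₂ (inj₁ (rot-cyc x y₁ (trans x∈v₁ (sym y₁∈v₁))) , c-touched)))
    identified-touched {x} (inj₂ (inj₁ x∈v₂)) =
      inj₁ (T₁.orbits-merge y₁≁y₂ (inj₂ (inj₂ (rot-cyc x y₂ (trans x∈v₂ (sym y₂∈v₂))) , c-touched)))
    identified-touched {x} (inj₂ (inj₂ x∈v₃)) =
      inj₂ (T₁.orbits-merge y₁≁y₂ (inj₁ (rot-cyc x y₃ (trans x∈v₃ (sym y₃∈v₃)))))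

    identified-embedding : IsDirEmbedding (D / φ) R′
    identified-embedding = record { rot-vert = rot-vert′ ; rot-cyc = rot-cyc′ ; directed = directed′ }
      where
      merged : ∀ x y → Among v₁ v₂ v₃ (vertOf D x) → Among v₁ v₂ v₃ (vertOf D y) →
               vertOf (D / φ) x ≡ vertOf (D / φ) y
      merged x y x∈ y∈ =
        trans (vertOf-/ D φ x) (trans (proj₁ (proj₂ identifies) _ _ x∈ y∈) (sym (vertOf-/ D φ y)))

      c∈v₁v₂ : Among v₁ v₂ v₃ (vertOf D c)
      c∈v₁v₂ = [ (λ { refl → inj₁ y₁∈v₁ }) , (λ { refl → inj₂ (inj₁ y₂∈v₂) }) ]′ c∈

      rot-vert′ : ∀ h → vertOf (D / φ) (rot R′ h) ≡ vertOf (D / φ) h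
      rot-vert′ h = begin
        vertOf (D / φ) (swap c y₃ (swap y₁ y₂ (rot R h)))
          ≡⟨ swap-resp {a = c} {b = y₃} (vertOf (D / φ)) (merged c y₃ c∈v₁v₂ (inj₂ (inj₂ y₃∈v₃))) ⟩
        vertOf (D / φ) (swap y₁ y₂ (rot R h))
          ≡⟨ swap-resp {a = y₁} {b = y₂} (vertOf (D / φ)) (merged y₁ y₂ (inj₁ y₁∈v₁) (inj₂ (inj₁ y₂∈v₂))) ⟩
        vertOf (D / φ) (rot R h)                           ≡⟨ vertOf-/ D φ (rot R h) ⟩
        φ (vertOf D (rot R h))                             ≡⟨ cong φ (rot-vert h) ⟩
        φ (vertOf D h)                                     ≡⟨ vertOf-/ D φ h ⟨
        vertOf (D / φ) h                                   ∎
        where open ≡-Reasoning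

      rot-cyc′ : ∀ h h′ → vertOf (D / φ) h ≡ vertOf (D / φ) h′ → SameOrbit (rot R′) h h′
      rot-cyc′ h h′ e with proj₂ (proj₂ identifies) _ _ (trans (sym (vertOf-/ D φ h)) (trans e (vertOf-/ D φ h′)))
      ... | inj₁ same      = T₂.orbits-merge c≁₁y₃ (inj₁ (T₁.orbits-merge y₁≁y₂ (inj₁ (rot-cyc h h′ same))))
      ... | inj₂ (h∈ , h′∈) = T₂.orbits-merge c≁₁y₃ (inj₂ (identified-touched h∈ , identified-touched h′∈))

      c-head : proj₂ c ≡ proj₂ y₃
      c-head = [ (λ { refl → trans y₁-head (sym y₃-head) }) , (λ { refl → trans y₂-head (sym y₃-head) }) ]′ c∈

      directed′ : ∀ h → proj₂ (faceStep R′ h) ≡ proj₂ h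
      directed′ h = trans (swap-resp {a = c} {b = y₃} proj₂ c-head)
                          (trans (swap-resp {a = y₁} {b = y₂} proj₂ (trans y₁-head (sym y₂-head))) (directed h))

lemma4p2 : (D : Digraph) → IsEulerian D →
  (R : Rotation D) → IsDirEmbedding D R →
  {n' : ℕ} (f : Fin (n D) → Fin n') (v₁ v₂ v₃ : Fin (n D)) →
  v₁ ≢ v₂ → v₁ ≢ v₃ → v₂ ≢ v₃ → IdentifiesThree f v₁ v₂ v₃ →
  (h₁ h₂ h₃ : HalfArc (m D)) →
  Antiface R h₁ → IncidentWith D R h₁ v₁ →
  Antiface R h₂ → IncidentWith D R h₂ v₂ →
  Antiface R h₃ → IncidentWith D R h₃ v₃ →
  Σ (Rotation (D / f)) λ R' →
    IsDirEmbedding (D / f) R' ×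
    (∀ h → ¬ (SameOrbit (faceStep R) h₁ h ⊎ SameOrbit (faceStep R) h₂ h ⊎ SameOrbit (faceStep R) h₃ h) →
      faceStep R' h ≡ faceStep R h) ×
    (∀ h → (SameOrbit (faceStep R) h₁ h ⊎ SameOrbit (faceStep R) h₂ h ⊎ SameOrbit (faceStep R) h₃ h) →
      Antiface R' h) ×
    (NumFaces (faceStep R) (λ h → SameOrbit (faceStep R) h₁ h ⊎ SameOrbit (faceStep R) h₂ h ⊎ SameOrbit (faceStep R) h₃ h) 3 →
      NumFaces (faceStep R') (λ h → SameOrbit (faceStep R) h₁ h ⊎ SameOrbit (faceStep R) h₂ h ⊎ SameOrbit (faceStep R) h₃ h) 1) ×
    (NumFaces (faceStep R) (λ h → SameOrbit (faceStep R) h₁ h ⊎ SameOrbit (faceStep R) h₂ h ⊎ SameOrbit (faceStep R) h₃ h) 2 →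
      NumFaces (faceStep R') (λ h → SameOrbit (faceStep R) h₁ h ⊎ SameOrbit (faceStep R) h₂ h ⊎ SameOrbit (faceStep R) h₃ h) 2) ×
    (NumFaces (faceStep R) (λ h → SameOrbit (faceStep R) h₁ h ⊎ SameOrbit (faceStep R) h₂ h ⊎ SameOrbit (faceStep R) h₃ h) 1 →
      NumFaces (faceStep R') (λ h → SameOrbit (faceStep R) h₁ h ⊎ SameOrbit (faceStep R) h₂ h ⊎ SameOrbit (faceStep R) h₃ h) 1) ×
    (∀ k k' → NumFaces (faceStep R) (λ h → SameOrbit (faceStep R) h₁ h ⊎ SameOrbit (faceStep R) h₂ h ⊎ SameOrbit (faceStep R) h₃ h) k →
      NumFaces (faceStep R') (λ h → SameOrbit (faceStep R) h₁ h ⊎ SameOrbit (faceStep R) h₂ h ⊎ SameOrbit (faceStep R) h₃ h) k' → k' ≤ k)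
lemma4p2 D _ R emb φ v₁ v₂ v₃ v₁≢v₂ v₁≢v₃ v₂≢v₃ identifies h₁ h₂ h₃
  anti₁ (y₁ , h₁~y₁ , y₁∈v₁) anti₂ (y₂ , h₂~y₂ , y₂∈v₂) anti₃ (y₃ , h₃~y₃ , y₃∈v₃)
  with c , c∈ , _ , before , after ← IdentifiedFaces.identified-faces (faceStep↔ R) y₁ y₂ y₃
         (vertOf-distinct D y₁∈v₁ y₂∈v₂ v₁≢v₂) (vertOf-distinct D y₂∈v₂ y₃∈v₃ v₂≢v₃)
  = R′ c∈ , identified-embedding c∈ , outside , antifaces ,
    identified-count-clauses (faceStep↔ R) σ′ (on-faces before) (on-faces after)
  where
  open VertexIdentification D R emb φ v₁≢v₂ v₁≢v₃ v₂≢v₃ identifies y₁∈v₁ y₂∈v₂ y₃∈v₃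
         (anti₁ y₁ h₁~y₁) (anti₂ y₂ h₂~y₂) (anti₃ y₃ h₃~y₃) using (R′; identified-embedding)
  open IdentifiedFaces.SecondTransposition (faceStep↔ R) y₁ y₂ y₃
         (vertOf-distinct D y₁∈v₁ y₂∈v₂ v₁≢v₂) (vertOf-distinct D y₂∈v₂ y₃∈v₃ v₂≢v₃) c c∈
  module O = Orbits (faceStep↔ R)

  y⇒h : ∀ {w} → O.InOrbits y₁ y₂ y₃ w → O.InOrbits h₁ h₂ h₃ w
  y⇒h = O.InOrbits-resp h₁~y₁ h₂~y₂ h₃~y₃

  h⇒y : ∀ {w} → O.InOrbits h₁ h₂ h₃ w → O.InOrbits y₁ y₂ y₃ w
  h⇒y = O.InOrbits-resp (O.~-sym h₁~y₁) (O.~-sym h₂~y₂) (O.~-sym h₃~y₃)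

  on-faces : ∀ {ψ j} → NumFaces ψ (O.InOrbits y₁ y₂ y₃) j → NumFaces ψ (O.InOrbits h₁ h₂ h₃) j
  on-faces = NumFaces-resp y⇒h h⇒y

  outside : ∀ h → ¬ O.InOrbits h₁ h₂ h₃ h → faceStep (R′ c∈) h ≡ faceStep R h
  outside h h∉ = agrees-outside (h∉ ∘ y⇒h)

  antifaces : ∀ h → O.InOrbits h₁ h₂ h₃ h → Antiface (R′ c∈) h
  antifaces h h∈ h′ h~′h′ = [ anti₁ h′ , [ anti₂ h′ , anti₃ h′ ]′ ]′ (y⇒h (InOrbits-closed′ (h⇒y h∈) h~′h′))
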